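{- Let $a_0,a_1$ be nodes of a Heyting algebra $\mathbf{A}$ with $a_0\leq a_1$. Then the set $\{b\in\mathbf{A}\mid b\leq a_0\}\cup\{b\in\mathbf{A}\mid a_1\leq b\}$ is the universe of a subalgebra of $\mathbf{A}$.
   Context: Heyting algebras are algebras $(A;\land,\lor,\to,\neg)$ with $(A;\land,\lor)$ a bounded distributive lattice, $\to$ the relative pseudocomplement and $\neg x=x\to\mathbf{0}$. An element is a node if it is comparable with every element of the algebra. -}

module Defs where

open import Level using (Level; _⊔_)
open import Data.Sum using (_⊎_)
open import Data.Product using (_×_)
open import Relation.Unary using (Pred)
open import Relation.Binary.Lattice.Bundles using (HeytingAlgebra)

module _ {c ℓ₁ ℓ₂ : Level} (A : HeytingAlgebra c ℓ₁ ℓ₂) where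
  open HeytingAlgebra A

  neg : Carrier → Carrier
  neg x = x ⇨ ⊥

  IsNode : Carrier → Set (c ⊔ ℓ₂)
  IsNode a = ∀ b → (a ≤ b) ⊎ (b ≤ a)

  record IsSubuniverse {ℓ : Level} (S : Pred Carrier ℓ) : Set (c ⊔ ℓ) where
    field
      ⊤-closed : S ⊤
      ⊥-closed : S ⊥
      ∧-closed : ∀ {x y} → S x → S y → S (x ∧ y)
      ∨-closed : ∀ {x y} → S x → S y → S (x ∨ y)
      ⇨-closed : ∀ {x y} → S x → S y → S (x ⇨ y)
      ¬-closed : ∀ {x} → S x → S (neg x)

  DownUp : Carrier → Carrier → Pred Carrier ℓ₂
  DownUp a₀ a₁ b = (b ≤ a₀) ⊎ (a₁ ≤ b)

{-# OPTIONS --safe #-}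
-- Down- and up-sets are closed under ∧ and ∨, and an up-set ↑a is closed under ⇨
-- because y ≤ x ⇨ y.  The only interesting case is x ⇨ y with y ≤ a₀: comparing
-- x ⇨ y with the node a₀ (if x ≤ a₀) or a₁ (if a₁ ≤ x) either puts it in the set
-- directly, or, by modus ponens x ∧ (x ⇨ y) ≤ y, forces x ≤ y (so x ⇨ y = ⊤)
-- or x ⇨ y ≤ y ≤ a₀.
module Submission where

open import Defs
open import Level using (Level)
open import Data.Sum using (_⊎_; inj₁; inj₂; map₁)
open import Relation.Binary.Lattice.Bundles using (HeytingAlgebra)
import Relation.Binary.Lattice.Properties.HeytingAlgebra as HeytingAlgebraProperties

module _ {c ℓ₁ ℓ₂ : Level} (A : HeytingAlgebra c ℓ₁ ℓ₂) where
  open HeytingAlgebra A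
  open HeytingAlgebraProperties A using (y≤x⇨y; ⇨-eval; ⇨-applyʳ)

  x≤x⇨y⇒x≤y : ∀ {x y} → x ≤ x ⇨ y → x ≤ y
  x≤x⇨y⇒x≤y x≤x⇨y = trans (∧-greatest refl x≤x⇨y) (⇨-applyʳ refl)

  x⇨y≤x⇒x⇨y≤y : ∀ {x y} → x ⇨ y ≤ x → x ⇨ y ≤ y
  x⇨y≤x⇒x⇨y≤y x⇨y≤x = trans (∧-greatest refl x⇨y≤x) ⇨-eval

  x≤y⇒⊤≤x⇨y : ∀ {x y} → x ≤ y → ⊤ ≤ x ⇨ y
  x≤y⇒⊤≤x⇨y {x} x≤y = transpose-⇨ (trans (x∧y≤y ⊤ x) x≤y)

  x≤node⇒x≤y⊎x⇨y≤node : ∀ {a x y} → IsNode A a → x ≤ a → (x ≤ y) ⊎ (x ⇨ y ≤ a)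
  x≤node⇒x≤y⊎x⇨y≤node {x = x} {y} a-node x≤a =
    map₁ (λ a≤x⇨y → x≤x⇨y⇒x≤y (trans x≤a a≤x⇨y)) (a-node (x ⇨ y))

  node≤x⇒node≤x⇨y⊎x⇨y≤y : ∀ {a x y} → IsNode A a → a ≤ x → (a ≤ x ⇨ y) ⊎ (x ⇨ y ≤ y)
  node≤x⇒node≤x⇨y⊎x⇨y≤y {x = x} {y} a-node a≤x with a-node (x ⇨ y)
  ... | inj₁ a≤x⇨y = inj₁ a≤x⇨y
  ... | inj₂ x⇨y≤a = inj₂ (x⇨y≤x⇒x⇨y≤y (trans x⇨y≤a a≤x))

  module _ {a₀ a₁ : Carrier} where
    private
      S = DownUp A a₀ a₁

    DownUp-∧-closed : ∀ {x y} → S x → S y → S (x ∧ y)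
    DownUp-∧-closed {x} {y} (inj₁ x≤a₀) _          = inj₁ (trans (x∧y≤x x y) x≤a₀)
    DownUp-∧-closed {x} {y} (inj₂ _)    (inj₁ y≤a₀) = inj₁ (trans (x∧y≤y x y) y≤a₀)
    DownUp-∧-closed         (inj₂ a₁≤x) (inj₂ a₁≤y) = inj₂ (∧-greatest a₁≤x a₁≤y)

    DownUp-∨-closed : ∀ {x y} → S x → S y → S (x ∨ y)
    DownUp-∨-closed         (inj₁ x≤a₀) (inj₁ y≤a₀) = inj₁ (∨-least x≤a₀ y≤a₀)
    DownUp-∨-closed {x} {y} (inj₁ _)    (inj₂ a₁≤y) = inj₂ (trans a₁≤y (y≤x∨y x y))
    DownUp-∨-closed {x} {y} (inj₂ a₁≤x) _          = inj₂ (trans a₁≤x (x≤x∨y x y))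

    DownUp-⇨-closed : IsNode A a₀ → IsNode A a₁ → ∀ {x y} → S x → S y → S (x ⇨ y)
    DownUp-⇨-closed _ _ _ (inj₂ a₁≤y) = inj₂ (trans a₁≤y y≤x⇨y)
    DownUp-⇨-closed a₀-node _ (inj₁ x≤a₀) (inj₁ _)
      with x≤node⇒x≤y⊎x⇨y≤node a₀-node x≤a₀
    ... | inj₁ x≤y    = inj₂ (trans (maximum a₁) (x≤y⇒⊤≤x⇨y x≤y))
    ... | inj₂ x⇨y≤a₀ = inj₁ x⇨y≤a₀
    DownUp-⇨-closed _ a₁-node (inj₂ a₁≤x) (inj₁ y≤a₀)
      with node≤x⇒node≤x⇨y⊎x⇨y≤y a₁-node a₁≤x
    ... | inj₁ a₁≤x⇨y = inj₂ a₁≤x⇨y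
    ... | inj₂ x⇨y≤y  = inj₁ (trans x⇨y≤y y≤a₀)

proposition7 : {c ℓ₁ ℓ₂ : Level} (A : HeytingAlgebra c ℓ₁ ℓ₂) (a₀ a₁ : HeytingAlgebra.Carrier A) →
    IsNode A a₀ → IsNode A a₁ → HeytingAlgebra._≤_ A a₀ a₁ →
    IsSubuniverse A (DownUp A a₀ a₁)
proposition7 A a₀ a₁ a₀-node a₁-node _ = record
  { ⊤-closed = inj₂ (maximum a₁)
  ; ⊥-closed = inj₁ (minimum a₀)
  ; ∧-closed = DownUp-∧-closed A
  ; ∨-closed = DownUp-∨-closed A
  ; ⇨-closed = ⇨-closed
  ; ¬-closed = λ x∈S → ⇨-closed x∈S (inj₁ (minimum a₀))
  }
  where
  open HeytingAlgebra A using (Carrier; _⇨_; maximum; minimum)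
  ⇨-closed : ∀ {x y : Carrier} → DownUp A a₀ a₁ x → DownUp A a₀ a₁ y → DownUp A a₀ a₁ (x ⇨ y)
  ⇨-closed = DownUp-⇨-closed A a₀-node a₁-node
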